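{- Let $\lambda$ be a nonzero real number, $r\ge0$ an integer and $m$ a positive integer. Then for every integer $n\ge r$, $$A_{n,\lambda}^{(r,-m)}(x)=\frac{(n)_{r}}{2^{m}}\sum_{k=0}^{m}\binom{m}{k}(k+x)_{n-r,\lambda}.$$ In particular, $A_{n,\lambda}^{(r,-m)}(0)=\frac{(n)_{r}}{2^{m}}\sum_{k=0}^{m}\binom{m}{k}(k)_{n-r,\lambda}$.
   Context: For nonzero real $\lambda$: $(x)_{0,\lambda}=1$, $(x)_{n,\lambda}=x(x-\lambda)\cdots(x-(n-1)\lambda)$ for $n\ge1$; $e_\lambda^x(t)=(1+\lambda t)^{x/\lambda}=\sum_{n\ge0}(x)_{n,\lambda}\frac{t^n}{n!}$, $e_\lambda(t)=e_\lambda^1(t)$. Ordinary falling factorial: $(y)_0=1$, $(y)_r=y(y-1)\cdots(y-r+1)$. For nonzero $\alpha\in\mathbb{C}$ and integer $r\ge0$, the generalized degenerate Euler-Genocchi polynomials of order $\alpha$ are defined by $t^{r}\Big(\frac{2}{e_{\lambda}(t)+1}\Big)^{\alpha}e_{\lambda}^{x}(t)=\sum_{n=0}^{\infty}A_{n,\lambda}^{(r,\alpha)}(x)\frac{t^{n}}{n!}$ (here with $\alpha=-m$). -}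

module Defs where

open import Level using (Level)
open import Algebra.Bundles using (CommutativeRing)
open import Data.Nat using (ℕ; zero; suc; _∸_; _≟_; _!)
open import Relation.Nullary using (yes; no)

-- Everything is developed over an arbitrary commutative ring R
-- (standing in for ℝ / ℂ), together with chosen inverses of the
-- positive integers: inv k is the inverse of (k + 1) in R.
module WithRing {c ℓ : Level} (R : CommutativeRing c ℓ) (inv : ℕ → CommutativeRing.Carrier R) where
  open CommutativeRing R

  natR : ℕ → Carrier
  natR zero    = 0#
  natR (suc n) = 1# + natR n

  powR : Carrier → ℕ → Carrier
  powR x zero    = 1#
  powR x (suc n) = powR x n * x

  sumR : ℕ → (ℕ → Carrier) → Carrier
  sumR zero    f = 0#
  sumR (suc n) f = sumR n f + f n

  dfall : Carrier → Carrier → ℕ → Carrier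
  dfall x lam zero    = 1#
  dfall x lam (suc n) = dfall x lam n * (x - natR n * lam)

  invFact : ℕ → Carrier
  invFact zero    = 1#
  invFact (suc n) = invFact n * inv n

  half : Carrier
  half = inv 1

  -- formal power series in t, given by their (ordinary) coefficient sequences
  Series : Set c
  Series = ℕ → Carrier

  constS : Carrier → Series
  constS a zero    = a
  constS a (suc n) = 0#

  _+S_ : Series → Series → Series
  (f +S g) n = f n + g n

  scaleS : Carrier → Series → Series
  scaleS a f n = a * f n

  _*S_ : Series → Series → Series
  (f *S g) n = sumR (suc n) (λ k → f k * g (n ∸ k))

  powS : Series → ℕ → Series
  powS f zero    = constS 1#
  powS f (suc m) = powS f m *S f

  tpow : ℕ → Series
  tpow r n with n ≟ r
  ... | yes _ = 1#
  ... | no  _ = 0#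

  eLamX : Carrier → Carrier → Series
  eLamX x lam n = dfall x lam n * invFact n

  eLam : Carrier → Series
  eLam lam = eLamX 1# lam

  -- (2 / (e_λ(t) + 1))^(-m) = ((e_λ(t) + 1) / 2)^m
  negPowFactor : Carrier → ℕ → Series
  negPowFactor lam m = powS (scaleS half (eLam lam +S constS 1#)) m

  -- A_{n,λ}^{(r,-m)}(x) : n! times the coefficient of t^n in
  -- t^r (2 / (e_λ(t) + 1))^(-m) e_λ^x(t)
  A : ℕ → ℕ → Carrier → Carrier → ℕ → Carrier
  A r m lam x n = natR (n !) * ((tpow r *S negPowFactor lam m) *S eLamX x lam) n

{-# OPTIONS --safe #-}
-- Once 1, 2, 3, ... are invertible, e_λ^x(t) e_λ^y(t) = e_λ^(x+y)(t) holds coefficientwise,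
-- so the binomial theorem gives ((e_λ(t) + 1) / 2)^m = 2^(-m) Σ_k C(m,k) e_λ^k(t), and
-- multiplying by e_λ^x(t) yields 2^(-m) Σ_k C(m,k) e_λ^(k+x)(t). The factor t^r only shifts
-- coefficients by r, and n! / (n - r)! = (n)_r.
module Submission where

open import Defs
open import Level using (Level)
open import Algebra.Bundles using (CommutativeRing)
open import Data.Empty using (⊥-elim)
open import Data.Nat using (ℕ; zero; suc; _≤_; _<_; _∸_; _!; _≟_; s≤s)
  renaming (_+_ to _+ℕ_; _*_ to _*ℕ_)
import Data.Nat.Properties as ℕ
open import Data.Nat.Combinatorics
  using (_P_; _C_; nPk≡n!/[n∸k]!; k>n⇒nCk≡0; nCk+nC[k+1]≡[n+1]C[k+1])
open import Data.Nat.DivMod using (m/n*n≡m)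
open import Data.Nat.Divisibility using (m≤n⇒m!∣n!)
open import Data.Product using (_×_; _,_)
open import Relation.Nullary using (¬_; yes; no)
open import Relation.Binary.PropositionalEquality as ≡ using (_≡_)

n!≡nPk*[n∸k]! : ∀ {n k} → k ≤ n → n ! ≡ (n P k) *ℕ (n ∸ k) !
n!≡nPk*[n∸k]! {n} {k} k≤n = ≡.sym (≡.trans (≡.cong (_*ℕ (n ∸ k) !) (nPk≡n!/[n∸k]! k≤n))
                                            (m/n*n≡m (m≤n⇒m!∣n! (ℕ.m∸n≤m n k))))
  where instance _ = ℕ._!≢0 (n ∸ k)

module EulerGenocchi {c ℓ : Level} (R : CommutativeRing c ℓ) (inv : ℕ → CommutativeRing.Carrier R) where
  open CommutativeRing R
  open WithRing R inv
  open import Algebra.Properties.Ring ring using (-‿+-comm; -0#≈0#)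
  open import Algebra.Properties.CommutativeSemigroup +-commutativeSemigroup
    using () renaming (interchange to +-interchange)
  open import Relation.Binary.Reasoning.Setoid setoid
  open import Algebra.Solver.Ring.NaturalCoefficients.Default commutativeSemiring
    using (solve; _:=_; _:+_; _:*_; con)

  [x-al]+[y-bl]≈[x+y]-[a+b]l : ∀ x y a b l → (x - a * l) + (y - b * l) ≈ (x + y) - (a + b) * l
  [x-al]+[y-bl]≈[x+y]-[a+b]l x y a b l = begin
    (x - a * l) + (y - b * l)          ≈⟨ +-interchange _ _ _ _ ⟩
    (x + y) + (- (a * l) + - (b * l))  ≈⟨ +-congˡ (-‿+-comm _ _) ⟩
    (x + y) - (a * l + b * l)          ≈⟨ +-congˡ (-‿cong (distribʳ l a b)) ⟨
    (x + y) - (a + b) * l              ∎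

  sumR-cong : ∀ n {f g : ℕ → Carrier} → (∀ k → k < n → f k ≈ g k) → sumR n f ≈ sumR n g
  sumR-cong zero    f≈g = refl
  sumR-cong (suc n) f≈g = +-cong (sumR-cong n (λ k k<n → f≈g k (ℕ.m<n⇒m<1+n k<n))) (f≈g n (ℕ.n<1+n n))

  sumR-zero : ∀ n {f : ℕ → Carrier} → (∀ k → k < n → f k ≈ 0#) → sumR n f ≈ 0#
  sumR-zero zero    f≈0 = refl
  sumR-zero (suc n) f≈0 =
    trans (+-cong (sumR-zero n (λ k k<n → f≈0 k (ℕ.m<n⇒m<1+n k<n))) (f≈0 n (ℕ.n<1+n n))) (+-identityʳ 0#)

  sumR-+ : ∀ n (f g : ℕ → Carrier) → sumR n (λ k → f k + g k) ≈ sumR n f + sumR n g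
  sumR-+ zero    f g = sym (+-identityʳ 0#)
  sumR-+ (suc n) f g = trans (+-congʳ (sumR-+ n f g)) (+-interchange _ _ _ _)

  sumR-*ˡ : ∀ n a (f : ℕ → Carrier) → a * sumR n f ≈ sumR n (λ k → a * f k)
  sumR-*ˡ zero    a f = zeroʳ a
  sumR-*ˡ (suc n) a f = trans (distribˡ a _ _) (+-congʳ (sumR-*ˡ n a f))

  sumR-*ʳ : ∀ n a (f : ℕ → Carrier) → sumR n f * a ≈ sumR n (λ k → f k * a)
  sumR-*ʳ n a f = trans (*-comm _ a) (trans (sumR-*ˡ n a f) (sumR-cong n (λ k _ → *-comm a (f k))))

  sumR-sucˡ : ∀ n (f : ℕ → Carrier) → sumR (suc n) f ≈ f 0 + sumR n (λ k → f (suc k))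
  sumR-sucˡ zero    f = +-comm 0# (f 0)
  sumR-sucˡ (suc n) f = trans (+-congʳ (sumR-sucˡ n f)) (+-assoc _ _ _)

  sumR-+ℕ : ∀ a b (f : ℕ → Carrier) → sumR (a +ℕ b) f ≈ sumR a f + sumR b (λ j → f (a +ℕ j))
  sumR-+ℕ a zero    f = trans (reflexive (≡.cong (λ t → sumR t f) (ℕ.+-identityʳ a))) (sym (+-identityʳ _))
  sumR-+ℕ a (suc b) f =
    trans (reflexive (≡.cong (λ t → sumR t f) (ℕ.+-suc a b))) (trans (+-congʳ (sumR-+ℕ a b f)) (+-assoc _ _ _))

  sumR-suc-+ℕ : ∀ a b (f : ℕ → Carrier) → sumR (suc (a +ℕ b)) f ≈ sumR a f + sumR (suc b) (λ j → f (a +ℕ j))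
  sumR-suc-+ℕ a b f = trans (reflexive (≡.cong (λ t → sumR t f) (≡.sym (ℕ.+-suc a b)))) (sumR-+ℕ a (suc b) f)

  sumR-swap : ∀ n m (f : ℕ → ℕ → Carrier) →
    sumR n (λ i → sumR m (λ j → f i j)) ≈ sumR m (λ j → sumR n (λ i → f i j))
  sumR-swap zero    m f = sym (sumR-zero m (λ _ _ → refl))
  sumR-swap (suc n) m f =
    trans (+-congʳ (sumR-swap n m f)) (sym (sumR-+ m (λ j → sumR n (λ i → f i j)) (λ j → f n j)))

  natR-+ : ∀ a b → natR (a +ℕ b) ≈ natR a + natR b
  natR-+ zero    b = sym (+-identityˡ _)
  natR-+ (suc a) b = trans (+-congˡ (natR-+ a b)) (sym (+-assoc _ _ _))

  natR-* : ∀ a b → natR (a *ℕ b) ≈ natR a * natR b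
  natR-* zero    b = sym (zeroˡ _)
  natR-* (suc a) b =
    trans (natR-+ b (a *ℕ b)) (trans (+-cong (sym (*-identityˡ _)) (natR-* a b)) (sym (distribʳ _ _ _)))

  sumR-pascal : ∀ m (F : ℕ → Carrier) →
    sumR (suc m) (λ k → natR (m C k) * (F (suc k) + F k)) ≈ sumR (suc (suc m)) (λ k → natR (suc m C k) * F k)
  sumR-pascal m F = begin
    sumR (suc m) (λ k → natR (m C k) * (F (suc k) + F k))
      ≈⟨ trans (sumR-cong (suc m) (λ k _ → distribˡ _ _ _)) (sumR-+ (suc m) _ _) ⟩
    X + sumR (suc m) (λ k → natR (m C k) * F k)
      ≈⟨ +-congˡ (sumR-sucˡ m _) ⟩
    X + (natR (m C 0) * F 0 + Y)
      ≈⟨ solve 3 (λ x a y → x :+ (a :+ y) := a :+ (x :+ y)) refl _ _ _ ⟩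
    natR (m C 0) * F 0 + (X + Y)
      ≈⟨ +-congˡ (+-congˡ (sym Y+top)) ⟩
    natR (suc m C 0) * F 0 + (X + sumR (suc m) (λ k → natR (m C suc k) * F (suc k)))
      ≈⟨ +-congˡ (sym (sumR-+ (suc m) _ _)) ⟩
    natR (suc m C 0) * F 0 + sumR (suc m) (λ k → natR (m C k) * F (suc k) + natR (m C suc k) * F (suc k))
      ≈⟨ +-congˡ (sumR-cong (suc m) (λ k _ → pascal-term k)) ⟩
    natR (suc m C 0) * F 0 + sumR (suc m) (λ k → natR (suc m C suc k) * F (suc k))
      ≈⟨ sym (sumR-sucˡ (suc m) _) ⟩
    sumR (suc (suc m)) (λ k → natR (suc m C k) * F k) ∎
    where
    X = sumR (suc m) (λ k → natR (m C k) * F (suc k))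
    Y = sumR m (λ k → natR (m C suc k) * F (suc k))
    Y+top : sumR (suc m) (λ k → natR (m C suc k) * F (suc k)) ≈ Y
    Y+top = trans (+-congˡ (trans (*-congʳ (reflexive (≡.cong natR (k>n⇒nCk≡0 (ℕ.n<1+n m))))) (zeroˡ _)))
                  (+-identityʳ _)
    pascal-term : ∀ k → natR (m C k) * F (suc k) + natR (m C suc k) * F (suc k) ≈ natR (suc m C suc k) * F (suc k)
    pascal-term k = trans (sym (distribʳ _ _ _))
      (*-congʳ (trans (sym (natR-+ (m C k) (m C suc k))) (reflexive (≡.cong natR (nCk+nC[k+1]≡[n+1]C[k+1] m k)))))

  infix 4 _≈S_
  _≈S_ : Series → Series → Set ℓ
  f ≈S g = ∀ n → f n ≈ g n

  *S-congˡ : ∀ {f f′} g → f ≈S f′ → (f *S g) ≈S (f′ *S g)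
  *S-congˡ g f≈f′ n = sumR-cong (suc n) (λ k _ → *-congʳ (f≈f′ k))

  constS-∸-< : ∀ a {k n} → k < n → constS a (n ∸ k) ≈ 0#
  constS-∸-< a (s≤s k≤n) rewrite ℕ.+-∸-assoc 1 k≤n = refl

  *S-identityʳ : ∀ f → (f *S constS 1#) ≈S f
  *S-identityʳ f n = begin
    sumR n (λ k → f k * constS 1# (n ∸ k)) + f n * constS 1# (n ∸ n)
      ≈⟨ +-cong (sumR-zero n (λ k k<n → trans (*-congˡ (constS-∸-< 1# k<n)) (zeroʳ _)))
                (*-congˡ (reflexive (≡.cong (constS 1#) (ℕ.n∸n≡0 n)))) ⟩
    0# + f n * 1#
      ≈⟨ trans (+-identityˡ _) (*-identityʳ _) ⟩
    f n ∎

  *S-sumˡ : ∀ M b (a : ℕ → Carrier) (F : ℕ → Series) (G : Series) s →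
    ((λ j → b * sumR M (λ k → a k * F k j)) *S G) s ≈ b * sumR M (λ k → a k * (F k *S G) s)
  *S-sumˡ M b a F G s = begin
    sumR (suc s) (λ j → b * sumR M (λ k → a k * F k j) * G (s ∸ j))
      ≈⟨ trans (sumR-cong (suc s) (λ j _ → *-assoc _ _ _)) (sym (sumR-*ˡ (suc s) b _)) ⟩
    b * sumR (suc s) (λ j → sumR M (λ k → a k * F k j) * G (s ∸ j))
      ≈⟨ *-congˡ (sumR-cong (suc s) (λ j _ → sumR-*ʳ M (G (s ∸ j)) _)) ⟩
    b * sumR (suc s) (λ j → sumR M (λ k → a k * F k j * G (s ∸ j)))
      ≈⟨ *-congˡ (sumR-swap (suc s) M _) ⟩
    b * sumR M (λ k → sumR (suc s) (λ j → a k * F k j * G (s ∸ j)))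
      ≈⟨ *-congˡ (sumR-cong M (λ k _ →
           trans (sumR-cong (suc s) (λ j _ → *-assoc _ _ _)) (sym (sumR-*ˡ (suc s) (a k) _)))) ⟩
    b * sumR M (λ k → a k * (F k *S G) s) ∎

  tpow-≢ : ∀ r {i} → ¬ i ≡ r → tpow r i ≈ 0#
  tpow-≢ r {i} i≢r with i ≟ r
  ... | yes i≡r = ⊥-elim (i≢r i≡r)
  ... | no  _   = refl

  tpow-≡ : ∀ r {i} → i ≡ r → tpow r i ≈ 1#
  tpow-≡ r {i} i≡r with i ≟ r
  ... | yes _   = refl
  ... | no  i≢r = ⊥-elim (i≢r i≡r)

  tpow-*S-< : ∀ r f {k} → k < r → (tpow r *S f) k ≈ 0#
  tpow-*S-< r f k<r = sumR-zero _ (λ i i≤k →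
    trans (*-congʳ (tpow-≢ r (ℕ.<⇒≢ (ℕ.≤-<-trans (ℕ.≤-pred i≤k) k<r)))) (zeroˡ _))

  tpow-*S-+ : ∀ r f j → (tpow r *S f) (r +ℕ j) ≈ f j
  tpow-*S-+ r f j = begin
    sumR (suc (r +ℕ j)) (λ i → tpow r i * f (r +ℕ j ∸ i))
      ≈⟨ sumR-suc-+ℕ r j _ ⟩
    sumR r (λ i → tpow r i * f (r +ℕ j ∸ i)) + sumR (suc j) (λ i → tpow r (r +ℕ i) * f (r +ℕ j ∸ (r +ℕ i)))
      ≈⟨ +-cong (sumR-zero r (λ i i<r → trans (*-congʳ (tpow-≢ r (ℕ.<⇒≢ i<r))) (zeroˡ _))) (sumR-sucˡ j _) ⟩
    0# + (tpow r (r +ℕ 0) * f (r +ℕ j ∸ (r +ℕ 0)) + sumR j (λ i → tpow r (r +ℕ suc i) * f (r +ℕ j ∸ (r +ℕ suc i))))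
      ≈⟨ +-congˡ (+-cong (*-cong (tpow-≡ r (ℕ.+-identityʳ r)) (reflexive (≡.cong f (ℕ.[m+n]∸[m+o]≡n∸o r j 0))))
                         (sumR-zero j (λ i _ → trans (*-congʳ (tpow-≢ r (ℕ.m+1+n≢m r))) (zeroˡ _)))) ⟩
    0# + (1# * f j + 0#)
      ≈⟨ trans (+-identityˡ _) (trans (+-identityʳ _) (*-identityˡ _)) ⟩
    f j ∎

  tpow-*S-*S : ∀ r f g {n} → r ≤ n → ((tpow r *S f) *S g) n ≈ (f *S g) (n ∸ r)
  tpow-*S-*S r f g {n} r≤n = begin
    ((tpow r *S f) *S g) n
      ≡⟨ ≡.cong ((tpow r *S f) *S g) (≡.sym (ℕ.m+[n∸m]≡n r≤n)) ⟩
    sumR (suc (r +ℕ s)) (λ k → (tpow r *S f) k * g (r +ℕ s ∸ k))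
      ≈⟨ sumR-suc-+ℕ r s _ ⟩
    sumR r (λ k → (tpow r *S f) k * g (r +ℕ s ∸ k))
      + sumR (suc s) (λ j → (tpow r *S f) (r +ℕ j) * g (r +ℕ s ∸ (r +ℕ j)))
      ≈⟨ +-cong (sumR-zero r (λ k k<r → trans (*-congʳ (tpow-*S-< r f k<r)) (zeroˡ _)))
                (sumR-cong (suc s) (λ j _ → *-cong (tpow-*S-+ r f j) (reflexive (≡.cong g (ℕ.[m+n]∸[m+o]≡n∸o r s j))))) ⟩
    0# + (f *S g) s
      ≈⟨ +-identityˡ _ ⟩
    (f *S g) s ∎
    where s = n ∸ r

  derivS : Series → Series
  derivS f n = natR (suc n) * f (suc n)

  derivS-*S : ∀ f g → derivS (f *S g) ≈S (derivS f *S g) +S (f *S derivS g)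
  derivS-*S f g n = begin
    natR (suc n) * sumR (suc (suc n)) h
      ≈⟨ sumR-*ˡ (suc (suc n)) _ h ⟩
    sumR (suc (suc n)) (λ k → natR (suc n) * h k)
      ≈⟨ sumR-cong (suc (suc n)) (λ k k≤1+n → split-weight k (ℕ.≤-pred k≤1+n)) ⟩
    sumR (suc (suc n)) (λ k → natR k * h k + natR (suc n ∸ k) * h k)
      ≈⟨ sumR-+ (suc (suc n)) _ _ ⟩
    sumR (suc (suc n)) (λ k → natR k * h k) + sumR (suc (suc n)) (λ k → natR (suc n ∸ k) * h k)
      ≈⟨ +-cong from-derivS-f from-derivS-g ⟩
    (derivS f *S g) n + (f *S derivS g) n ∎
    where
    h : ℕ → Carrier
    h k = f k * g (suc n ∸ k)
    split-weight : ∀ k → k ≤ suc n → natR (suc n) * h k ≈ natR k * h k + natR (suc n ∸ k) * h k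
    split-weight k k≤1+n =
      trans (*-congʳ (trans (reflexive (≡.cong natR (≡.sym (ℕ.m+[n∸m]≡n k≤1+n)))) (natR-+ k _))) (distribʳ _ _ _)
    from-derivS-f : sumR (suc (suc n)) (λ k → natR k * h k) ≈ (derivS f *S g) n
    from-derivS-f = begin
      sumR (suc (suc n)) (λ k → natR k * h k)
        ≈⟨ sumR-sucˡ (suc n) _ ⟩
      0# * h 0 + sumR (suc n) (λ j → natR (suc j) * h (suc j))
        ≈⟨ trans (+-congʳ (zeroˡ _)) (+-identityˡ _) ⟩
      sumR (suc n) (λ j → natR (suc j) * h (suc j))
        ≈⟨ sumR-cong (suc n) (λ j _ → sym (*-assoc _ _ _)) ⟩
      (derivS f *S g) n ∎
    from-derivS-g : sumR (suc (suc n)) (λ k → natR (suc n ∸ k) * h k) ≈ (f *S derivS g) n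
    from-derivS-g = begin
      sumR (suc n) (λ k → natR (suc n ∸ k) * h k) + natR (n ∸ n) * h (suc n)
        ≈⟨ +-congˡ (trans (*-congʳ (reflexive (≡.cong natR (ℕ.n∸n≡0 n)))) (zeroˡ _)) ⟩
      sumR (suc n) (λ k → natR (suc n ∸ k) * h k) + 0#
        ≈⟨ +-identityʳ _ ⟩
      sumR (suc n) (λ k → natR (suc n ∸ k) * h k)
        ≈⟨ sumR-cong (suc n) (λ k k≤n → term k (ℕ.≤-pred k≤n)) ⟩
      (f *S derivS g) n ∎
      where
      term : ∀ k → k ≤ n → natR (suc n ∸ k) * h k ≈ f k * derivS g (n ∸ k)
      term k k≤n rewrite ℕ.+-∸-assoc 1 k≤n = solve 3 (λ a b c → a :* (b :* c) := b :* (a :* c)) refl _ _ _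

  dfall-cong : ∀ {x x′} lam → x ≈ x′ → ∀ n → dfall x lam n ≈ dfall x′ lam n
  dfall-cong lam x≈x′ zero    = refl
  dfall-cong lam x≈x′ (suc n) = *-cong (dfall-cong lam x≈x′ n) (+-congʳ x≈x′)

  eLamX-cong : ∀ {x x′} lam → x ≈ x′ → eLamX x lam ≈S eLamX x′ lam
  eLamX-cong lam x≈x′ n = *-congʳ (dfall-cong lam x≈x′ n)

  dfall-0#-suc : ∀ lam n → dfall 0# lam (suc n) ≈ 0#
  dfall-0#-suc lam zero    =
    trans (*-identityˡ _) (trans (+-congˡ (-‿cong (zeroˡ lam))) (trans (+-identityˡ _) -0#≈0#))
  dfall-0#-suc lam (suc n) = trans (*-congʳ (dfall-0#-suc lam n)) (zeroˡ _)

  eLamX-0# : ∀ lam → eLamX 0# lam ≈S constS 1#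
  eLamX-0# lam zero    = *-identityˡ 1#
  eLamX-0# lam (suc n) = trans (*-congʳ (dfall-0#-suc lam n)) (zeroˡ _)

  module _ (inv-natR : ∀ k → natR (suc k) * inv k ≈ 1#) (lam : Carrier) where

    natR-!*invFact : ∀ n → natR (n !) * invFact n ≈ 1#
    natR-!*invFact zero    = trans (*-identityʳ _) (+-identityʳ 1#)
    natR-!*invFact (suc n) = begin
      natR (suc n *ℕ n !) * (invFact n * inv n)
        ≈⟨ *-congʳ (natR-* (suc n) (n !)) ⟩
      natR (suc n) * natR (n !) * (invFact n * inv n)
        ≈⟨ solve 4 (λ a b c d → a :* b :* (c :* d) := (a :* d) :* (b :* c)) refl _ _ _ _ ⟩
      (natR (suc n) * inv n) * (natR (n !) * invFact n)
        ≈⟨ *-cong (inv-natR n) (natR-!*invFact n) ⟩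
      1# * 1#
        ≈⟨ *-identityˡ 1# ⟩
      1# ∎

    natR-suc-cancelˡ : ∀ n {a b} → natR (suc n) * a ≈ natR (suc n) * b → a ≈ b
    natR-suc-cancelˡ n {a} {b} na≈nb = begin
      a                            ≈⟨ recover a ⟨
      inv n * (natR (suc n) * a)   ≈⟨ *-congˡ na≈nb ⟩
      inv n * (natR (suc n) * b)   ≈⟨ recover b ⟩
      b                            ∎
      where
      recover : ∀ z → inv n * (natR (suc n) * z) ≈ z
      recover z = trans (sym (*-assoc _ _ _)) (trans (*-congʳ (trans (*-comm _ _) (inv-natR n))) (*-identityˡ z))

    derivS-eLamX : ∀ x n → derivS (eLamX x lam) n ≈ eLamX x lam n * (x - natR n * lam)
    derivS-eLamX x n = begin
      natR (suc n) * (dfall x lam n * (x - natR n * lam) * (invFact n * inv n))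
        ≈⟨ solve 5 (λ N d u F i → N :* (d :* u :* (F :* i)) := (N :* i) :* (d :* F :* u)) refl _ _ _ _ _ ⟩
      (natR (suc n) * inv n) * (dfall x lam n * invFact n * (x - natR n * lam))
        ≈⟨ trans (*-congʳ (inv-natR n)) (*-identityˡ _) ⟩
      eLamX x lam n * (x - natR n * lam) ∎

    -- The coefficients of e_λ^x are determined by their first one and the recursion in
    -- derivS-eLamX, and the Leibniz rule shows that e_λ^x e_λ^y satisfies that of e_λ^(x+y).
    eLamX-+ : ∀ x y → (eLamX x lam *S eLamX y lam) ≈S eLamX (x + y) lam
    eLamX-+ x y zero    = trans (+-identityˡ _) (trans (*-congʳ (*-identityˡ 1#)) (*-identityˡ _))
    eLamX-+ x y (suc n) = natR-suc-cancelˡ n (begin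
      derivS (eˣ *S eʸ) n
        ≈⟨ derivS-*S eˣ eʸ n ⟩
      (derivS eˣ *S eʸ) n + (eˣ *S derivS eʸ) n
        ≈⟨ sym (sumR-+ (suc n) _ _) ⟩
      sumR (suc n) (λ j → derivS eˣ j * eʸ (n ∸ j) + eˣ j * derivS eʸ (n ∸ j))
        ≈⟨ sumR-cong (suc n) (λ j j≤n → term j (ℕ.≤-pred j≤n)) ⟩
      sumR (suc n) (λ j → eˣ j * eʸ (n ∸ j) * (x + y - natR n * lam))
        ≈⟨ sym (sumR-*ʳ (suc n) _ _) ⟩
      (eˣ *S eʸ) n * (x + y - natR n * lam)
        ≈⟨ *-congʳ (eLamX-+ x y n) ⟩
      eLamX (x + y) lam n * (x + y - natR n * lam)
        ≈⟨ derivS-eLamX (x + y) n ⟨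
      derivS (eLamX (x + y) lam) n ∎)
      where
      eˣ = eLamX x lam
      eʸ = eLamX y lam
      term : ∀ j → j ≤ n →
        derivS eˣ j * eʸ (n ∸ j) + eˣ j * derivS eʸ (n ∸ j) ≈ eˣ j * eʸ (n ∸ j) * (x + y - natR n * lam)
      term j j≤n = begin
        derivS eˣ j * eʸ (n ∸ j) + eˣ j * derivS eʸ (n ∸ j)
          ≈⟨ +-cong (*-congʳ (derivS-eLamX x j)) (*-congˡ (derivS-eLamX y (n ∸ j))) ⟩
        eˣ j * (x - natR j * lam) * eʸ (n ∸ j) + eˣ j * (eʸ (n ∸ j) * (y - natR (n ∸ j) * lam))
          ≈⟨ solve 4 (λ a b u v → a :* u :* b :+ a :* (b :* v) := a :* b :* (u :+ v)) refl _ _ _ _ ⟩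
        eˣ j * eʸ (n ∸ j) * ((x - natR j * lam) + (y - natR (n ∸ j) * lam))
          ≈⟨ *-congˡ ([x-al]+[y-bl]≈[x+y]-[a+b]l x y _ _ lam) ⟩
        eˣ j * eʸ (n ∸ j) * (x + y - (natR j + natR (n ∸ j)) * lam)
          ≈⟨ *-congˡ (+-congˡ (-‿cong (*-congʳ (trans (sym (natR-+ j (n ∸ j)))
                                                     (reflexive (≡.cong natR (ℕ.m+[n∸m]≡n j≤n))))))) ⟩
        eˣ j * eʸ (n ∸ j) * (x + y - natR n * lam) ∎

    half[eλ+1] : Series
    half[eλ+1] = scaleS half (eLam lam +S constS 1#)

    eLamX-natR-*S-half[eλ+1] : ∀ k →
      (eLamX (natR k) lam *S half[eλ+1]) ≈S (λ j → half * (eLamX (natR (suc k)) lam j + eLamX (natR k) lam j))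
    eLamX-natR-*S-half[eλ+1] k j = begin
      sumR (suc j) (λ i → eᵏ i * (half * (eLam lam (j ∸ i) + constS 1# (j ∸ i))))
        ≈⟨ sumR-cong (suc j) (λ i _ →
             solve 4 (λ f h p q → f :* (h :* (p :+ q)) := h :* (f :* p :+ f :* q)) refl _ _ _ _) ⟩
      sumR (suc j) (λ i → half * (eᵏ i * eLam lam (j ∸ i) + eᵏ i * constS 1# (j ∸ i)))
        ≈⟨ trans (sym (sumR-*ˡ (suc j) half _)) (*-congˡ (sumR-+ (suc j) _ _)) ⟩
      half * ((eᵏ *S eLam lam) j + (eᵏ *S constS 1#) j)
        ≈⟨ *-congˡ (+-cong (trans (eLamX-+ (natR k) 1# j) (eLamX-cong lam (+-comm _ _) j)) (*S-identityʳ eᵏ j)) ⟩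
      half * (eLamX (natR (suc k)) lam j + eᵏ j) ∎
      where eᵏ = eLamX (natR k) lam

    negPowFactor-binomial : ∀ m →
      negPowFactor lam m ≈S (λ j → powR half m * sumR (suc m) (λ k → natR (m C k) * eLamX (natR k) lam j))
    negPowFactor-binomial zero    j =
      trans (sym (eLamX-0# lam j)) (solve 1 (λ e → e := con 1 :* (con 0 :+ (con 1 :+ con 0) :* e)) refl _)
    negPowFactor-binomial (suc m) j = begin
      (negPowFactor lam m *S half[eλ+1]) j
        ≈⟨ *S-congˡ half[eλ+1] (negPowFactor-binomial m) j ⟩
      ((λ i → h * sumR (suc m) (λ k → natR (m C k) * eLamX (natR k) lam i)) *S half[eλ+1]) j
        ≈⟨ *S-sumˡ (suc m) h (λ k → natR (m C k)) (λ k → eLamX (natR k) lam) half[eλ+1] j ⟩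
      h * sumR (suc m) (λ k → natR (m C k) * (eLamX (natR k) lam *S half[eλ+1]) j)
        ≈⟨ *-congˡ (sumR-cong (suc m) (λ k _ → *-congˡ (eLamX-natR-*S-half[eλ+1] k j))) ⟩
      h * sumR (suc m) (λ k → natR (m C k) * (half * (e (suc k) + e k)))
        ≈⟨ *-congˡ (trans (sumR-cong (suc m) (λ k _ → solve 3 (λ a b c → a :* (b :* c) := b :* (a :* c)) refl _ _ _))
                          (sym (sumR-*ˡ (suc m) half _))) ⟩
      h * (half * sumR (suc m) (λ k → natR (m C k) * (e (suc k) + e k)))
        ≈⟨ *-congˡ (*-congˡ (sumR-pascal m e)) ⟩
      h * (half * sumR (suc (suc m)) (λ k → natR (suc m C k) * e k))
        ≈⟨ *-assoc _ _ _ ⟨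
      powR half (suc m) * sumR (suc (suc m)) (λ k → natR (suc m C k) * e k) ∎
      where
      h = powR half m
      e : ℕ → Carrier
      e k = eLamX (natR k) lam j

    A-closed-form : ∀ r m x {n} → r ≤ n →
      A r m lam x n ≈ natR (n P r) * powR half m * sumR (suc m) (λ k → natR (m C k) * dfall (natR k + x) lam (n ∸ r))
    A-closed-form r m x {n} r≤n = begin
      natR (n !) * ((tpow r *S negPowFactor lam m) *S eLamX x lam) n
        ≈⟨ *-congˡ (tpow-*S-*S r (negPowFactor lam m) (eLamX x lam) r≤n) ⟩
      natR (n !) * (negPowFactor lam m *S eLamX x lam) s
        ≈⟨ *-congˡ (*S-congˡ (eLamX x lam) (negPowFactor-binomial m) s) ⟩
      natR (n !) * ((λ j → h * sumR (suc m) (λ k → natR (m C k) * eLamX (natR k) lam j)) *S eLamX x lam) s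
        ≈⟨ *-congˡ (*S-sumˡ (suc m) h (λ k → natR (m C k)) (λ k → eLamX (natR k) lam) (eLamX x lam) s) ⟩
      natR (n !) * (h * sumR (suc m) (λ k → natR (m C k) * (eLamX (natR k) lam *S eLamX x lam) s))
        ≈⟨ *-congˡ (*-congˡ (sumR-cong (suc m) (λ k _ →
             trans (*-congˡ (eLamX-+ (natR k) x s)) (sym (*-assoc _ _ _))))) ⟩
      natR (n !) * (h * sumR (suc m) (λ k → natR (m C k) * d k * invFact s))
        ≈⟨ *-cong (trans (reflexive (≡.cong natR (n!≡nPk*[n∸k]! r≤n))) (natR-* (n P r) (s !)))
                  (*-congˡ (sym (sumR-*ʳ (suc m) _ _))) ⟩
      natR (n P r) * natR (s !) * (h * (S * invFact s))
        ≈⟨ solve 5 (λ a b c d e → a :* b :* (c :* (d :* e)) := a :* c :* d :* (b :* e)) refl _ _ _ _ _ ⟩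
      natR (n P r) * h * S * (natR (s !) * invFact s)
        ≈⟨ trans (*-congˡ (natR-!*invFact s)) (*-identityʳ _) ⟩
      natR (n P r) * h * S ∎
      where
      s = n ∸ r
      h = powR half m
      d : ℕ → Carrier
      d k = dfall (natR k + x) lam s
      S = sumR (suc m) (λ k → natR (m C k) * d k)

-- The identity holds for every λ and m.
theorem3 : ∀ {c ℓ : Level} (R : CommutativeRing c ℓ) (inv : ℕ → CommutativeRing.Carrier R) →
    let open CommutativeRing R
        open WithRing R inv
    in (∀ k → natR (suc k) * inv k ≈ 1#) →
       (lam : Carrier) → ¬ (lam ≈ 0#) →
       (r m : ℕ) → 1 ≤ m → (x : Carrier) → (n : ℕ) → r ≤ n →
       (A r m lam x n ≈ natR (n P r) * powR half m
                          * sumR (suc m) (λ k → natR (m C k) * dfall (natR k + x) lam (n ∸ r)))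
       × (A r m lam 0# n ≈ natR (n P r) * powR half m
                          * sumR (suc m) (λ k → natR (m C k) * dfall (natR k) lam (n ∸ r)))
theorem3 R inv inv-natR lam _ r m _ x n r≤n =
  A-closed-form inv-natR lam r m x r≤n ,
  trans (A-closed-form inv-natR lam r m 0# r≤n)
        (*-congˡ (sumR-cong (suc m) (λ k _ → *-congˡ (dfall-cong lam (+-identityʳ (natR k)) (n ∸ r)))))
  where
  open CommutativeRing R
  open WithRing R inv
  open EulerGenocchi R inv
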